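{- Let $\vdash_1^-$ be the smallest relation $\vdash\subseteq Form\times Form$ satisfying all the basic rules, (Abs) and ($\neg\neg$I). Then $\vdash_1^-$ does not satisfy (Prop$_1$); that is, (Prop$_1$) is not derivable from the other defining rules of $\vdash_1$.
   Context: Formulas are built from a countable set $PL$ of propositional letters and the constant $\bot$ using binary connectives $\land,\lor,\to$; $Form$ is the set of formulas; $\neg\alpha:=\alpha\to\bot$, $\top:=\bot\to\bot$; precedence $\neg>\land=\lor>\to$. A relation $\vdash\subseteq Form\times Form$; "$\vdash\alpha$" means $\chi\vdash\alpha$ for all $\chi$. Basic rules (all formulas, all $n\ge1$): (A) $\alpha\vdash\alpha$; (Cut) $\alpha\vdash\beta,\beta\vdash\gamma\Rightarrow\alpha\vdash\gamma$; ($\bot$) $\bot\vdash\alpha$; ($\land$R) $\chi\vdash\alpha,\chi\vdash\beta\Rightarrow\chi\vdash\alpha\land\beta$; ($\land$L) $\alpha\land\beta\vdash\alpha$, $\alpha\land\beta\vdash\beta$; ($\lor$R) $\alpha\vdash\alpha\lor\beta$, $\beta\vdash\alpha\lor\beta$; ($\lor$L) $\alpha\vdash\chi,\beta\vdash\chi\Rightarrow\alpha\lor\beta\vdash\chi$; (DT$_0$) $\alpha\vdash\beta\Rightarrow\ \vdash\alpha\to\beta$; ($\to\land$) $(\alpha\to\beta)\land(\alpha\to\gamma)\vdash\alpha\to\beta\land\gamma$; ($\to$tr) $(\alpha\to\beta)\land(\beta\to\gamma)\vdash\alpha\to\gamma$; ($\to$-$\lor$.s) $\bigvee_{j\le n}(\alpha_j\to\beta_j)\land\bigwedge_j(\psi_j\land\beta_j\to\chi)\vdash\bigwedge_j(\psi_j\land\alpha_j)\to\chi$.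 (Abs) $\alpha\land\neg\alpha\vdash\bot$; ($\neg\neg$I) $\alpha\vdash\neg\neg\alpha$. i-formulas: expressions $\Delta\sqsupset\Theta$ with $\Delta,\Theta$ nonempty finite subsets of $Form$; $Form^i$ is their set. $\Vdash_1\subseteq\wp(Form^i)\times Form^i$ is the least relation satisfying: (A) $\Gamma^i\cup\{\alpha^i\}\Vdash\alpha^i$; (Cut) $\Gamma^i\Vdash\alpha^i$ and $\Phi^i\cup\{\alpha^i\}\Vdash\beta^i$ imply $\Gamma^i\cup\Phi^i\Vdash\beta^i$; (i-A) if $\Delta\cap\Theta\neq\emptyset$ then $\emptyset\Vdash\Delta\sqsupset\Theta$; (i-Cut) $\{\Delta_1\sqsupset\Theta_1\cup\{\varphi\},\Delta_2\cup\{\varphi\}\sqsupset\Theta_2\}\Vdash\Delta_1\cup\Delta_2\sqsupset\Theta_1\cup\Theta_2$; (i-$\land$L) $\emptyset\Vdash\{\varphi\land\psi\}\sqsupset\{\varphi\}$ and $\emptyset\Vdash\{\varphi\land\psi\}\sqsupset\{\psi\}$; (i-$\land$R) $\emptyset\Vdash\{\varphi,\psi\}\sqsupset\{\varphi\land\psi\}$. For $\gamma\in Form$ and $\Gamma\subseteq Form$: $i_\gamma(\Gamma)=\{\{\varphi_1,\dots,\varphi_n\}\sqsupset\{\psi_1,\dots,\psi_n\}\mid n\ge1,\ \bigvee_j(\varphi_j\to\psi_j)\lor\gamma\in\Gamma\}$; $Th_\vdash(\alpha)=\{\varphi\mid\alpha\vdash\varphi\}$. A relation $\vdash$ satisfies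 (Prop$_1$) iff for all formulas $\alpha,\gamma$: if $i_\gamma(Th_\vdash(\alpha))\Vdash_1\{\top\}\sqsupset\{\bot\}$ then $\alpha\vdash\gamma$. $\vdash_1$ is the smallest relation satisfying the basic rules, (Abs), ($\neg\neg$I) and (Prop$_1$). -}

module Defs where

open import Data.Nat using (ℕ)
open import Data.Product using (Σ; ∃; _×_; _,_; proj₁; proj₂)
open import Data.Sum using (_⊎_)
open import Data.Empty renaming (⊥ to Empty)
open import Data.List using (List; []; _∷_)
open import Data.List.NonEmpty as L⁺ using (List⁺; _∷_; _⁺++_; _++⁺_; _∷ʳ_; [_]; toList)
open import Data.List.Membership.Propositional using (_∈_)
open import Relation.Binary.PropositionalEquality using (_≡_)

infixr 6 _∧_
infixr 6 _∨_
infixr 5 _⇒_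

data Form : Set where
  var : ℕ → Form
  ⊥ : Form
  _∧_ _∨_ _⇒_ : Form → Form → Form

∼_ : Form → Form
∼ α = α ⇒ ⊥

⊤ : Form
⊤ = ⊥ ⇒ ⊥

⋁′ : Form → List Form → Form
⋁′ x [] = x
⋁′ x (y ∷ ys) = x ∨ ⋁′ y ys

⋁ : List⁺ Form → Form
⋁ (x ∷ xs) = ⋁′ x xs

⋀′ : Form → List Form → Form
⋀′ x [] = x
⋀′ x (y ∷ ys) = x ∧ ⋀′ y ys

⋀ : List⁺ Form → Form
⋀ (x ∷ xs) = ⋀′ x xs

-- index data for the rule (→-∨.s): triples (α_j , β_j , ψ_j)
record Tri : Set where
  constructor tri
  field
    a b ψ : Form
open Tri

infix 3 _⊢⁻_

data _⊢⁻_ : Form → Form → Set where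
  ax   : ∀ {α} → α ⊢⁻ α
  cut  : ∀ {α β γ} → α ⊢⁻ β → β ⊢⁻ γ → α ⊢⁻ γ
  ⊥L   : ∀ {α} → ⊥ ⊢⁻ α
  ∧R   : ∀ {χ α β} → χ ⊢⁻ α → χ ⊢⁻ β → χ ⊢⁻ α ∧ β
  ∧L₁  : ∀ {α β} → α ∧ β ⊢⁻ α
  ∧L₂  : ∀ {α β} → α ∧ β ⊢⁻ β
  ∨R₁  : ∀ {α β} → α ⊢⁻ α ∨ β
  ∨R₂  : ∀ {α β} → β ⊢⁻ α ∨ β
  ∨L   : ∀ {α β χ} → α ⊢⁻ χ → β ⊢⁻ χ → α ∨ β ⊢⁻ χ
  DT₀  : ∀ {α β} χ → α ⊢⁻ β → χ ⊢⁻ α ⇒ β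
  ⇒∧   : ∀ {α β γ} → (α ⇒ β) ∧ (α ⇒ γ) ⊢⁻ α ⇒ β ∧ γ
  ⇒tr  : ∀ {α β γ} → (α ⇒ β) ∧ (β ⇒ γ) ⊢⁻ α ⇒ γ
  ⇒∨s  : ∀ (ts : List⁺ Tri) χ →
         ⋁ (L⁺.map (λ t → a t ⇒ b t) ts) ∧ ⋀ (L⁺.map (λ t → ψ t ∧ b t ⇒ χ) ts)
           ⊢⁻ ⋀ (L⁺.map (λ t → ψ t ∧ a t) ts) ⇒ χ
  Abs  : ∀ {α} → α ∧ ∼ α ⊢⁻ ⊥
  ¬¬I  : ∀ {α} → α ⊢⁻ ∼ ∼ α

-- i-formulas Δ ⊐ Θ (Δ, Θ nonempty finite sets of formulas), represented
-- by nonempty lists and compared up to equality of element sets.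

record IForm : Set where
  constructor _⊐_
  field
    ante succ : List⁺ Form
open IForm

infix 4 _≐ᶠ_ _≈ⁱ_ _∈ˢ_ _≐_

_≐ᶠ_ : List⁺ Form → List⁺ Form → Set
Δ ≐ᶠ Δ' = ∀ x → (x ∈ toList Δ → x ∈ toList Δ') × (x ∈ toList Δ' → x ∈ toList Δ)

_≈ⁱ_ : IForm → IForm → Set
(Δ ⊐ Θ) ≈ⁱ (Δ' ⊐ Θ') = (Δ ≐ᶠ Δ') × (Θ ≐ᶠ Θ')

ISet : Set₁
ISet = IForm → Set

_∈ˢ_ : IForm → ISet → Set
φ ∈ˢ Γ = ∃ λ φ' → (φ' ≈ⁱ φ) × Γ φ'

_≐_ : ISet → ISet → Set
Γ ≐ Ψ = ∀ φ → (φ ∈ˢ Γ → φ ∈ˢ Ψ) × (φ ∈ˢ Ψ → φ ∈ˢ Γ)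

∅ : ISet
∅ _ = Empty

⟦_⟧ : IForm → ISet
⟦ φ ⟧ x = x ≡ φ

pair : IForm → IForm → ISet
pair φ ψ x = (x ≡ φ) ⊎ (x ≡ ψ)

_∪_ : ISet → ISet → ISet
(Γ ∪ Φ) x = Γ x ⊎ Φ x

infix 3 _⊩₁_

data _⊩₁_ : ISet → IForm → Set₁ where
  A    : ∀ {Ψ Γ φ} → Ψ ≐ Γ ∪ ⟦ φ ⟧ → Ψ ⊩₁ φ
  Cut  : ∀ {Γ Φ Φα Ψ φ ψ} → Γ ⊩₁ φ → Φα ⊩₁ ψ → Φα ≐ Φ ∪ ⟦ φ ⟧ → Ψ ≐ Γ ∪ Φ → Ψ ⊩₁ ψ
  i-A  : ∀ {Ψ Δ Θ} → Ψ ≐ ∅ → (∃ λ x → x ∈ toList Δ × x ∈ toList Θ) → Ψ ⊩₁ Δ ⊐ Θ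
  i-Cut : ∀ {Ψ} (Δ₁ : List⁺ Form) (Θ₁ : List Form) (φ : Form) (Δ₂ : List Form) (Θ₂ : List⁺ Form) →
          Ψ ≐ pair (Δ₁ ⊐ (Θ₁ ∷ʳ φ)) ((φ ∷ Δ₂) ⊐ Θ₂) →
          Ψ ⊩₁ (Δ₁ ⁺++ Δ₂) ⊐ (Θ₁ ++⁺ Θ₂)
  i-∧L₁ : ∀ {Ψ} φ ψ → Ψ ≐ ∅ → Ψ ⊩₁ [ φ ∧ ψ ] ⊐ [ φ ]
  i-∧L₂ : ∀ {Ψ} φ ψ → Ψ ≐ ∅ → Ψ ⊩₁ [ φ ∧ ψ ] ⊐ [ ψ ]
  i-∧R  : ∀ {Ψ} φ ψ → Ψ ≐ ∅ → Ψ ⊩₁ (φ ∷ ψ ∷ []) ⊐ [ φ ∧ ψ ]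

⋁⇒ : List⁺ (Form × Form) → Form
⋁⇒ ps = ⋁ (L⁺.map (λ p → proj₁ p ⇒ proj₂ p) ps)

i[_] : Form → (Form → Set) → ISet
i[ γ ] Γ φ = ∃ λ (ps : List⁺ (Form × Form)) →
               (φ ≈ⁱ (L⁺.map proj₁ ps ⊐ L⁺.map proj₂ ps)) × Γ (⋁⇒ ps ∨ γ)

Th : (Form → Form → Set) → Form → Form → Set
Th _⊢_ α φ = α ⊢ φ

Prop₁ : (Form → Form → Set) → Set₁
Prop₁ _⊢_ = ∀ α γ → i[ γ ] (Th _⊢_ α) ⊩₁ [ ⊤ ] ⊐ [ ⊥ ] → α ⊢ γ

-- Put α₀ = ((⊤ → p) ∨ γ) ∧ (¬p ∨ γ). Then i_γ(Th α₀) contains {⊤} ⊐ {p} and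
-- {p} ⊐ {⊥}, which i-Cut to {⊤} ⊐ {⊥}, so (Prop₁) would force α₀ ⊢ γ.
-- But ⊢₁⁻ is sound for an interpretation in the non-distributive lattice N5
-- (𝟘 < g < c < 𝟙, 𝟘 < a < 𝟙): its prime filters ↑a and ↑g serve as two
-- classical worlds, and x ⇨ y is the greatest element holding exactly at the
-- worlds where x → y holds. Each world then evaluates formulas classically, so
-- every implication rule is sound because it is classically valid. The worlds
-- cannot tell g from c, and indeed p ↦ a, γ ↦ g sends α₀ to c ≰ g.

module Submission where

open import Defs
open import Data.Bool using (Bool; true; false; T; if_then_else_)
open import Data.Empty renaming (⊥ to Empty)
open import Data.List using ([]; _∷_)
open import Data.List.NonEmpty as L⁺ using (List⁺; _∷_; [_])
open import Data.Nat using (ℕ; zero; suc)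
open import Data.Product using (_×_; _,_)
open import Data.Product.Function.NonDependent.Propositional using (_×-⇔_)
open import Data.Sum as Sum using (_⊎_; inj₁; inj₂; swap)
open import Data.Sum.Function.Propositional using (_⊎-⇔_)
open import Function using (id)
open import Function.Bundles using (_⇔_; mk⇔; Equivalence)
import Function.Properties.Equivalence as ⇔
open import Function.Related.TypeIsomorphisms using (→-cong-⇔)
open import Relation.Binary.PropositionalEquality using (refl)
open import Relation.Nullary using (¬_)
open import Relation.Nullary.Decidable
  using (Dec; does; T?; map′; from-yes; from-no; ¬?; _×-dec_; _⊎-dec_; _→-dec_)

open Equivalence using (to; from)

data N5 : Set where
  𝟘 g c a 𝟙 : N5

_≤ᵇ_ : N5 → N5 → Bool
𝟘 ≤ᵇ _ = true
_ ≤ᵇ 𝟙 = true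
g ≤ᵇ g = true
g ≤ᵇ c = true
c ≤ᵇ c = true
a ≤ᵇ a = true
_ ≤ᵇ _ = false

record _≤_ (x y : N5) : Set where
  constructor ≤ᵇ⇒≤
  field ≤⇒≤ᵇ : T (x ≤ᵇ y)

infix 4 _≤_ _≤?_

_≤?_ : ∀ x y → Dec (x ≤ y)
x ≤? y = map′ ≤ᵇ⇒≤ _≤_.≤⇒≤ᵇ (T? (x ≤ᵇ y))

∀? : {P : N5 → Set} → (∀ x → Dec (P x)) → Dec (∀ x → P x)
∀? P? = map′
  (λ { (p𝟘 , pg , pc , pa , p𝟙) → λ { 𝟘 → p𝟘 ; g → pg ; c → pc ; a → pa ; 𝟙 → p𝟙 } })
  (λ p → p 𝟘 , p g , p c , p a , p 𝟙)
  (P? 𝟘 ×-dec P? g ×-dec P? c ×-dec P? a ×-dec P? 𝟙)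

data World : Set where
  ↑a ↑g : World

generator : World → N5
generator ↑a = a
generator ↑g = g

_⊨_ : World → N5 → Set
w ⊨ x = generator w ≤ x

_⊨?_ : ∀ w x → Dec (w ⊨ x)
w ⊨? x = generator w ≤? x

infix 4 _⊨_ _⊨?_

∀World? : {P : World → Set} → (∀ w → Dec (P w)) → Dec (∀ w → P w)
∀World? P? =
  map′ (λ { (pa , pg) → λ { ↑a → pa ; ↑g → pg } }) (λ p → p ↑a , p ↑g) (P? ↑a ×-dec P? ↑g)

greatest : (World → Bool) → N5
greatest f with f ↑a | f ↑g
... | true  | true  = 𝟙
... | true  | false = a
... | false | true  = c
... | false | false = 𝟘

infixr 7 _⊓_
infixr 6 _⊔_
infixr 5 _⇨_

-- Opaque so that unification can read x and y off x ⊓ y, x ⊔ y and x ⇨ y.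
opaque
  -- the only incomparable pairs are a with g or c, whose meet is 𝟘 and join 𝟙
  _⊓_ _⊔_ : N5 → N5 → N5
  x ⊓ y = if x ≤ᵇ y then x else if y ≤ᵇ x then y else 𝟘
  x ⊔ y = if x ≤ᵇ y then y else if y ≤ᵇ x then x else 𝟙

  _⇨_ : N5 → N5 → N5
  x ⇨ y = greatest λ w → does (w ⊨? x →-dec w ⊨? y)

𝟘-least : ∀ {x} → 𝟘 ≤ x
𝟘-least = ≤ᵇ⇒≤ _

≤-refl : ∀ {x} → x ≤ x
≤-refl {x} = from-yes (∀? λ x → x ≤? x) x

≤-trans : ∀ {x y z} → x ≤ y → y ≤ z → x ≤ z
≤-trans {x} {y} {z} =
  from-yes (∀? λ x → ∀? λ y → ∀? λ z → x ≤? y →-dec y ≤? z →-dec x ≤? z) x y z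

⊭𝟘 : ∀ w → ¬ w ⊨ 𝟘
⊭𝟘 = from-yes (∀World? λ w → ¬? (w ⊨? 𝟘))

⊨-mono : ∀ {w x y} → x ≤ y → w ⊨ x → w ⊨ y
⊨-mono x≤y w⊨x = ≤-trans w⊨x x≤y

opaque
  unfolding _⊓_ _⊔_ _⇨_

  ⊓-lower₁ : ∀ {x y} → x ⊓ y ≤ x
  ⊓-lower₁ {x} {y} = from-yes (∀? λ x → ∀? λ y → x ⊓ y ≤? x) x y

  ⊓-lower₂ : ∀ {x y} → x ⊓ y ≤ y
  ⊓-lower₂ {x} {y} = from-yes (∀? λ x → ∀? λ y → x ⊓ y ≤? y) x y

  ⊓-greatest : ∀ {x y z} → x ≤ y → x ≤ z → x ≤ y ⊓ z
  ⊓-greatest {x} {y} {z} =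
    from-yes (∀? λ x → ∀? λ y → ∀? λ z → x ≤? y →-dec x ≤? z →-dec x ≤? y ⊓ z) x y z

  ⊔-upper₁ : ∀ {x y} → x ≤ x ⊔ y
  ⊔-upper₁ {x} {y} = from-yes (∀? λ x → ∀? λ y → x ≤? x ⊔ y) x y

  ⊔-upper₂ : ∀ {x y} → y ≤ x ⊔ y
  ⊔-upper₂ {x} {y} = from-yes (∀? λ x → ∀? λ y → y ≤? x ⊔ y) x y

  ⊔-least : ∀ {x y z} → x ≤ z → y ≤ z → x ⊔ y ≤ z
  ⊔-least {x} {y} {z} =
    from-yes (∀? λ x → ∀? λ y → ∀? λ z → x ≤? z →-dec y ≤? z →-dec x ⊔ y ≤? z) x y z

  ⊓-⇨𝟘 : ∀ {x} → x ⊓ (x ⇨ 𝟘) ≤ 𝟘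
  ⊓-⇨𝟘 {x} = from-yes (∀? λ x → x ⊓ (x ⇨ 𝟘) ≤? 𝟘) x

  ⊨-prime : ∀ w {x y} → w ⊨ x ⊔ y → w ⊨ x ⊎ w ⊨ y
  ⊨-prime w {x} {y} = from-yes
    (∀World? λ w → ∀? λ x → ∀? λ y → w ⊨? x ⊔ y →-dec (w ⊨? x ⊎-dec w ⊨? y)) w x y

  ⊨-⇨ : ∀ w {x y} → w ⊨ x ⇨ y ⇔ (w ⊨ x → w ⊨ y)
  ⊨-⇨ w {x} {y} = mk⇔
    (from-yes (∀World? λ w → ∀? λ x → ∀? λ y → w ⊨? x ⇨ y →-dec w ⊨? x →-dec w ⊨? y) w x y)
    (from-yes (∀World? λ w → ∀? λ x → ∀? λ y → (w ⊨? x →-dec w ⊨? y) →-dec w ⊨? x ⇨ y) w x y)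

  ≤-⇨ : ∀ {x y z} → (∀ w → w ⊨ z → w ⊨ x → w ⊨ y) → z ≤ x ⇨ y
  ≤-⇨ {x} {y} {z} = from-yes
    (∀? λ x → ∀? λ y → ∀? λ z →
       ∀World? (λ w → w ⊨? z →-dec w ⊨? x →-dec w ⊨? y) →-dec z ≤? x ⇨ y) x y z

⊨-⊓ : ∀ w {x y} → w ⊨ x ⊓ y ⇔ (w ⊨ x × w ⊨ y)
⊨-⊓ w = mk⇔ (λ w⊨x⊓y → ⊨-mono ⊓-lower₁ w⊨x⊓y , ⊨-mono ⊓-lower₂ w⊨x⊓y)
            (λ (w⊨x , w⊨y) → ⊓-greatest w⊨x w⊨y)

⊨-⊔ : ∀ w {x y} → w ⊨ x ⊔ y ⇔ (w ⊨ x ⊎ w ⊨ y)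
⊨-⊔ w = mk⇔ (⊨-prime w) Sum.[ ⊨-mono ⊔-upper₁ , ⊨-mono ⊔-upper₂ ]

Holds : (ℕ → Set) → Form → Set
Holds v (var n) = v n
Holds v ⊥ = Empty
Holds v (α ∧ β) = Holds v α × Holds v β
Holds v (α ∨ β) = Holds v α ⊎ Holds v β
Holds v (α ⇒ β) = Holds v α → Holds v β

⇒∨s-premise : List⁺ Tri → Form → Form
⇒∨s-premise ts χ =
  ⋁ (L⁺.map (λ t → Tri.a t ⇒ Tri.b t) ts) ∧ ⋀ (L⁺.map (λ t → Tri.ψ t ∧ Tri.b t ⇒ χ) ts)

⇒∨s-antecedent : List⁺ Tri → Form
⇒∨s-antecedent ts = ⋀ (L⁺.map (λ t → Tri.ψ t ∧ Tri.a t) ts)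

⇒∨s-holds : ∀ v ts χ → Holds v (⇒∨s-premise ts χ) → Holds v (⇒∨s-antecedent ts) → Holds v χ
⇒∨s-holds v (_ ∷ []) χ (f , k) (hψ , ha) = k (hψ , f ha)
⇒∨s-holds v (_ ∷ _ ∷ _) χ (inj₁ f , k , _) ((hψ , ha) , _) = k (hψ , f ha)
⇒∨s-holds v (_ ∷ t ∷ ts) χ (inj₂ disj , _ , conj) (_ , conj′) =
  ⇒∨s-holds v (t ∷ ts) χ (disj , conj) conj′

module Semantics (ρ : ℕ → N5) where

  ⟪_⟫ : Form → N5
  ⟪ var n ⟫ = ρ n
  ⟪ ⊥ ⟫ = 𝟘
  ⟪ α ∧ β ⟫ = ⟪ α ⟫ ⊓ ⟪ β ⟫
  ⟪ α ∨ β ⟫ = ⟪ α ⟫ ⊔ ⟪ β ⟫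
  ⟪ α ⇒ β ⟫ = ⟪ α ⟫ ⇨ ⟪ β ⟫

  _⊩_ : World → Form → Set
  w ⊩ α = Holds (λ n → w ⊨ ρ n) α

  infix 4 _⊩_

  ⊨⟪⟫⇔⊩ : ∀ w α → w ⊨ ⟪ α ⟫ ⇔ w ⊩ α
  ⊨⟪⟫⇔⊩ w (var n) = ⇔.refl
  ⊨⟪⟫⇔⊩ w ⊥ = mk⇔ (⊭𝟘 w) λ ()
  ⊨⟪⟫⇔⊩ w (α ∧ β) = ⇔.trans (⊨-⊓ w) (⊨⟪⟫⇔⊩ w α ×-⇔ ⊨⟪⟫⇔⊩ w β)
  ⊨⟪⟫⇔⊩ w (α ∨ β) = ⇔.trans (⊨-⊔ w) (⊨⟪⟫⇔⊩ w α ⊎-⇔ ⊨⟪⟫⇔⊩ w β)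
  ⊨⟪⟫⇔⊩ w (α ⇒ β) = ⇔.trans (⊨-⇨ w) (→-cong-⇔ (⊨⟪⟫⇔⊩ w α) (⊨⟪⟫⇔⊩ w β))

  ≤-⇒ : ∀ χ α β → (∀ w → w ⊩ χ → w ⊩ α → w ⊩ β) → ⟪ χ ⟫ ≤ ⟪ α ⇒ β ⟫
  ≤-⇒ χ α β valid = ≤-⇨ λ w z x →
    from (⊨⟪⟫⇔⊩ w β) (valid w (to (⊨⟪⟫⇔⊩ w χ) z) (to (⊨⟪⟫⇔⊩ w α) x))

  sound : ∀ {α β} → α ⊢⁻ β → ⟪ α ⟫ ≤ ⟪ β ⟫
  sound ax = ≤-refl
  sound (cut d e) = ≤-trans (sound d) (sound e)
  sound ⊥L = 𝟘-least
  sound (∧R d e) = ⊓-greatest (sound d) (sound e)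
  sound ∧L₁ = ⊓-lower₁
  sound ∧L₂ = ⊓-lower₂
  sound ∨R₁ = ⊔-upper₁
  sound ∨R₂ = ⊔-upper₂
  sound (∨L d e) = ⊔-least (sound d) (sound e)
  sound (DT₀ {α} {β} χ d) =
    ≤-⇒ χ α β λ w _ x → to (⊨⟪⟫⇔⊩ w β) (⊨-mono (sound d) (from (⊨⟪⟫⇔⊩ w α) x))
  sound (⇒∧ {α} {β} {γ}) = ≤-⇒ ((α ⇒ β) ∧ (α ⇒ γ)) α (β ∧ γ) λ _ (f , h) x → f x , h x
  sound (⇒tr {α} {β} {γ}) = ≤-⇒ ((α ⇒ β) ∧ (β ⇒ γ)) α γ λ _ (f , h) x → h (f x)
  sound (⇒∨s ts χ) =
    ≤-⇒ (⇒∨s-premise ts χ) (⇒∨s-antecedent ts) χ λ _ → ⇒∨s-holds _ ts χ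
  sound Abs = ⊓-⇨𝟘
  sound (¬¬I {α}) = ≤-⇒ α (∼ α) ⊥ λ _ x ¬x → ¬x x

≐-pointwise : ∀ {Γ Ψ : ISet} → (∀ φ → Γ φ → Ψ φ) → (∀ φ → Ψ φ → Γ φ) → Γ ≐ Ψ
≐-pointwise Γ⊆Ψ Ψ⊆Γ _ = (λ (φ′ , φ′≈φ , m) → φ′ , φ′≈φ , Γ⊆Ψ φ′ m)
                      , (λ (φ′ , φ′≈φ , m) → φ′ , φ′≈φ , Ψ⊆Γ φ′ m)

≐-refl : ∀ {Γ} → Γ ≐ Γ
≐-refl = ≐-pointwise (λ _ → id) (λ _ → id)

assumption : ∀ {Γ φ} → Γ φ → Γ ⊩₁ φ
assumption Γφ = A (≐-pointwise (λ _ → inj₁) λ { _ (inj₁ m) → m ; _ (inj₂ refl) → Γφ })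

cut₂ : ∀ {Γ φ ψ χ} → Γ ⊩₁ φ → Γ ⊩₁ ψ → pair φ ψ ⊩₁ χ → Γ ⊩₁ χ
cut₂ {Γ} {ψ = ψ} Γ⊩φ Γ⊩ψ φψ⊩χ =
  Cut {Φ = Γ} Γ⊩ψ
    (Cut {Φ = ⟦ ψ ⟧} Γ⊩φ φψ⊩χ (≐-pointwise (λ _ → swap) (λ _ → swap)) ≐-refl)
    ≐-refl
    (≐-pointwise (λ _ → inj₁) (λ _ → Sum.[ id , id ]))

i-singleton : ∀ {Γ γ φ ψ} → Γ ((φ ⇒ ψ) ∨ γ) → i[ γ ] Γ ([ φ ] ⊐ [ ψ ])
i-singleton Γφψγ = [ _ , _ ] , ((λ _ → id , id) , (λ _ → id , id)) , Γφψγ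

i-inconsistent : ∀ Γ {γ φ} → Γ ((⊤ ⇒ φ) ∨ γ) → Γ (∼ φ ∨ γ) → i[ γ ] Γ ⊩₁ [ ⊤ ] ⊐ [ ⊥ ]
i-inconsistent Γ {γ} {φ} ⊤⇒φ∨γ ¬φ∨γ =
  cut₂ (assumption (i-singleton {Γ} {γ} ⊤⇒φ∨γ)) (assumption (i-singleton {Γ} {γ} ¬φ∨γ))
       (i-Cut [ ⊤ ] [] φ [] [ ⊥ ] ≐-refl)

p γ₀ α₀ : Form
p = var 0
γ₀ = var 1
α₀ = ((⊤ ⇒ p) ∨ γ₀) ∧ (∼ p ∨ γ₀)

ρ₀ : ℕ → N5
ρ₀ zero = a
ρ₀ (suc zero) = g
ρ₀ (suc (suc _)) = 𝟘

opaque
  unfolding _⊓_ _⊔_ _⇨_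

  α₀⊬γ₀ : ¬ (α₀ ⊢⁻ γ₀)
  α₀⊬γ₀ α₀⊢γ₀ = from-no (c ≤? g) (Semantics.sound ρ₀ α₀⊢γ₀)

lemma9 : ¬ Prop₁ _⊢⁻_
lemma9 prop₁ = α₀⊬γ₀ (prop₁ α₀ γ₀ (i-inconsistent (Th _⊢⁻_ α₀) ∧L₁ ∧L₂))
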